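{- Let $n,k \ge 1$ be integers, let $\ell_1,\dots,\ell_n \in \{1,2,\dots\}$ be levels, and define $C_{\ell,i} = \sum_{j=1}^{i}\mathbf{1}[\ell_j=\ell]$ (with $C_{\ell,0}=0$) and $p_i = \sum_{\ell \ge 1 : C_{\ell,i-1} < k} 2^{ -\ell}$ for $1 \le i \le n$. Let $\delta\in(0,1)$ with $k \ge 8\log(1/\delta)$ and $b = k - \lceil \sqrt{2k\log(1/\delta)}\rceil$. Suppose that $C_{\ell,\min(2^\ell b, n)} < k$ for every $\ell \ge 1$. Then $p_i = 1$ for all $i \le 2b$, and $p_i \ge b/i$ for all $i > 2b$.
   Context: $\log$ is the natural logarithm. The levels $\ell_i$ are those of the elements $x_1,\dots,x_n$ of a dataset ordered by decreasing value of a nonnegative function $f_q$. -}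

module Defs where

open import Data.Nat as ℕ using (ℕ; zero; suc; _∸_; _<?_; _≟_)
open import Data.Fin using (Fin; toℕ)
open import Data.Bool using (Bool; true; false; _∧_)
open import Relation.Nullary.Decidable using (⌊_⌋)
open import Data.Integer using (+_)
open import Data.Rational using (ℚ; 0ℚ; 1ℚ; ½; _+_; _*_; _/_)

sumFin : (n : ℕ) → (Fin n → ℕ) → ℕ
sumFin zero    f = 0
sumFin (suc n) f = f Fin.zero ℕ.+ sumFin n (λ j → f (Fin.suc j))

maxFin : (n : ℕ) → (Fin n → ℕ) → ℕ
maxFin zero    f = 0
maxFin (suc n) f = f Fin.zero ℕ.⊔ maxFin n (λ j → f (Fin.suc j))

𝟙 : Bool → ℕ
𝟙 true  = 1
𝟙 false = 0

-- Levels ℓ_1..ℓ_n are given as lev : Fin n → ℕ, with lev j = ℓ_{j+1}.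
-- C lev ℓ i = C_{ℓ,i} = Σ_{j=1}^{i} 1[ℓ_j = ℓ]   (for 0 ≤ i ≤ n)
C : {n : ℕ} → (Fin n → ℕ) → ℕ → ℕ → ℕ
C {n} lev ℓ i = sumFin n (λ j → 𝟙 (⌊ toℕ j <? i ⌋ ∧ ⌊ lev j ≟ ℓ ⌋))

half^ : ℕ → ℚ
half^ zero    = 1ℚ
half^ (suc m) = ½ * half^ m

S : {n : ℕ} → (Fin n → ℕ) → (k i M : ℕ) → ℚ
S lev k i zero    = 0ℚ
S lev k i (suc M) = S lev k i M + (if ⌊ C lev (suc M) (i ∸ 1) <? k ⌋ then half^ (suc M) else 0ℚ)
  where open import Data.Bool using (if_then_else_)

-- p_i = Σ_{ℓ ≥ 1 : C_{ℓ,i-1} < k} 2^{-ℓ}.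
-- With M = max level, every ℓ > M has C_{ℓ,i-1} = 0 < k (as k ≥ 1), and
-- Σ_{ℓ > M} 2^{-ℓ} = 2^{-M}; hence this infinite series equals the
-- finite expression below exactly (for k ≥ 1).
p : {n : ℕ} → (Fin n → ℕ) → (k i : ℕ) → ℚ
p {n} lev k i = S lev k i M + half^ M
  where M = maxFin n lev

{-# OPTIONS --safe #-}
module Submission where

-- C_{ℓ,i} is monotone in i, so the hypothesis keeps level ℓ active (C_{ℓ,i-1} < k) for all i ≤ 2^ℓ b.
-- For i ≤ 2b every level is active and p_i = Σ_{ℓ≥1} 2^-ℓ = 1.  For i > 2b choose m with
-- 2^m b ≤ i < 2^(m+1) b: every level above m is active, so p_i ≥ Σ_{ℓ>m} 2^-ℓ = 2^-m ≥ b/i.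

open import Defs
open import Data.Nat using (ℕ; _≤_; _<_; _*_; _∸_; _^_; _⊓_; _+_)
open import Data.Fin using (Fin)
open import Data.Integer using (+_)
open import Data.Rational using (ℚ; 1ℚ; _/_) renaming (_≤_ to _≤ℚ_; _<_ to _<ℚ_; _*_ to _*ℚ_)
open import Data.Product using (Σ; _×_)
open import Relation.Binary.PropositionalEquality using (_≡_)

open import Data.Nat using (zero; suc; s≤s; z≤n; _<?_; _≤?_)
import Data.Nat.Properties as ℕ
import Data.Fin as Fin
open import Data.Fin using (toℕ)
open import Data.Bool using (Bool; true; false; _∧_; if_then_else_)
open import Relation.Nullary using (Dec; yes; no)
open import Relation.Nullary.Decidable using (⌊_⌋; dec-true; isYes≗does)
open import Data.Rational using (0ℚ; ½; mkℚ; toℚᵘ; nonNegative; *≤*) renaming (_+_ to _+ℚ_)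
import Data.Rational.Properties as ℚ
import Data.Rational.Unnormalised as ℚᵘ
import Data.Rational.Unnormalised.Properties as ℚᵘ
import Data.Integer as ℤ
import Data.Integer.Properties as ℤ
open import Data.Nat.Coprimality using (1-coprimeTo) renaming (sym to coprime-sym)
open import Data.Product using (_,_; ∃)
open import Relation.Binary.PropositionalEquality using (refl; sym; trans; cong; cong₂; subst; module ≡-Reasoning)
open import Relation.Nullary.Negation using (contradiction)

⌊⌋≡true : ∀ {A : Set} (a? : Dec A) → A → ⌊ a? ⌋ ≡ true
⌊⌋≡true a? a = trans (isYes≗does a?) (dec-true a? a)

sumFin-mono-≤ : ∀ n {f g : Fin n → ℕ} → (∀ j → f j ≤ g j) → sumFin n f ≤ sumFin n g
sumFin-mono-≤ zero    f≤g = z≤n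
sumFin-mono-≤ (suc n) f≤g = ℕ.+-mono-≤ (f≤g Fin.zero) (sumFin-mono-≤ n (λ j → f≤g (Fin.suc j)))

𝟙-<?-∧-mono : ∀ x {a a'} (c : Bool) → a ≤ a' → 𝟙 (⌊ x <? a ⌋ ∧ c) ≤ 𝟙 (⌊ x <? a' ⌋ ∧ c)
𝟙-<?-∧-mono x {a} {a'} c a≤a' with x <? a | x <? a'
... | no _    | _        = z≤n
... | yes _   | yes _    = ℕ.≤-refl
... | yes x<a | no x≮a' = contradiction (ℕ.<-≤-trans x<a a≤a') x≮a'

C-monoʳ-≤ : ∀ {n} (lev : Fin n → ℕ) ℓ {a a'} → a ≤ a' → C lev ℓ a ≤ C lev ℓ a'
C-monoʳ-≤ {n} lev ℓ a≤a' = sumFin-mono-≤ n (λ j → 𝟙-<?-∧-mono (toℕ j) _ a≤a')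

Active : ∀ {n} → (Fin n → ℕ) → (k i ℓ : ℕ) → Set
Active lev k i ℓ = C lev ℓ (i ∸ 1) < k

FewPerLevel : ∀ {n} → (Fin n → ℕ) → (k b : ℕ) → Set
FewPerLevel {n} lev k b = ∀ ℓ → 1 ≤ ℓ → C lev ℓ ((2 ^ ℓ * b) ⊓ n) < k

active-above : ∀ {n} (lev : Fin n → ℕ) {k b i} m → FewPerLevel lev k b →
               i ≤ n → i ≤ 2 ^ suc m * b → ∀ ℓ → suc m ≤ ℓ → Active lev k i ℓ
active-above {n} lev {k} {b} {i} m few i≤n i≤2^[1+m]b ℓ 1+m≤ℓ =
  ℕ.≤-<-trans (C-monoʳ-≤ lev ℓ i-1≤bound) (few ℓ (ℕ.≤-trans (s≤s z≤n) 1+m≤ℓ))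
  where
  i-1≤i : i ∸ 1 ≤ i
  i-1≤i = ℕ.m∸n≤m i 1
  i≤2^ℓb : i ≤ 2 ^ ℓ * b
  i≤2^ℓb = ℕ.≤-trans i≤2^[1+m]b (ℕ.*-monoˡ-≤ b (ℕ.^-monoʳ-≤ 2 1+m≤ℓ))
  i-1≤bound : i ∸ 1 ≤ (2 ^ ℓ * b) ⊓ n
  i-1≤bound = ℕ.⊓-glb (ℕ.≤-trans i-1≤i i≤2^ℓb) (ℕ.≤-trans i-1≤i i≤n)

dyadic-bracket : ∀ {b i} → 1 ≤ b → b ≤ i → ∃ λ m → 2 ^ m * b ≤ i × i < 2 ^ suc m * b
dyadic-bracket {b} {i} 1≤b b≤i = subst (λ j → ∃ λ m → 2 ^ m * b ≤ j × j < 2 ^ suc m * b)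
                                       (ℕ.m+[n∸m]≡n b≤i) (bracket (i ∸ b))
  where
  bracket : ∀ d → ∃ λ m → 2 ^ m * b ≤ b + d × b + d < 2 ^ suc m * b
  bracket zero = 0 , ℕ.≤-refl , ℕ.+-monoʳ-< b (ℕ.≤-trans 1≤b (ℕ.m≤m+n b 0))
  bracket (suc d) with bracket d
  ... | m , lower , upper with b + suc d <? 2 ^ suc m * b
  ...   | yes upper′ = m , ℕ.≤-trans lower (ℕ.+-monoʳ-≤ b (ℕ.n≤1+n d)) , upper′
  ...   | no ¬upper′ = suc m , ℕ.≮⇒≥ ¬upper′ , double-bound
    where
    open ℕ.≤-Reasoning
    X : ℕ
    X = 2 ^ suc m * b
    double-bound : b + suc d < 2 ^ suc (suc m) * b
    double-bound = begin-strict
      b + suc d    ≡⟨ ℕ.+-suc b d ⟩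
      suc (b + d)  ≤⟨ upper ⟩
      X            <⟨ ℕ.m<m+n X (ℕ.≤-<-trans z≤n upper) ⟩
      X + X        ≡⟨ cong (λ y → X + y) (sym (ℕ.+-identityʳ X)) ⟩
      2 * X        ≡⟨ sym (ℕ.*-assoc 2 (2 ^ suc m) b) ⟩
      2 ^ suc (suc m) * b ∎

half^-nonNeg : ∀ m → 0ℚ ≤ℚ half^ m
half^-nonNeg zero    = ℚ.≤ᵇ⇒≤ _
half^-nonNeg (suc m) = ℚ.*-monoˡ-≤-nonNeg ½ (half^-nonNeg m)

half^-suc≤half^ : ∀ m → half^ (suc m) ≤ℚ half^ m
half^-suc≤half^ m = subst (half^ (suc m) ≤ℚ_) (ℚ.*-identityˡ (half^ m))
  (ℚ.*-monoʳ-≤-nonNeg (half^ m) {{nonNegative (half^-nonNeg m)}} {½} {1ℚ} (ℚ.≤ᵇ⇒≤ _))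

half^-antimono-≤ : ∀ {m m'} → m ≤ m' → half^ m' ≤ℚ half^ m
half^-antimono-≤ {m} {m'} m≤m' = subst (λ j → half^ j ≤ℚ half^ m) (ℕ.m∸n+n≡m m≤m') (drop (m' ∸ m))
  where
  drop : ∀ d → half^ (d + m) ≤ℚ half^ m
  drop zero    = ℚ.≤-refl
  drop (suc d) = ℚ.≤-trans (half^-suc≤half^ (d + m)) (drop d)

half^-suc+half^-suc : ∀ m → half^ (suc m) +ℚ half^ (suc m) ≡ half^ m
half^-suc+half^-suc m = trans (sym (ℚ.*-distribʳ-+ (half^ m) ½ ½)) (ℚ.*-identityˡ (half^ m))

S-nonNeg : ∀ {n} (lev : Fin n → ℕ) k i M → 0ℚ ≤ℚ S lev k i M
S-nonNeg lev k i zero    = ℚ.≤-refl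
S-nonNeg lev k i (suc M) = ℚ.+-mono-≤ (S-nonNeg lev k i M) (term-nonNeg ⌊ C lev (suc M) (i ∸ 1) <? k ⌋)
  where
  term-nonNeg : ∀ c → 0ℚ ≤ℚ (if c then half^ (suc M) else 0ℚ)
  term-nonNeg true  = half^-nonNeg (suc M)
  term-nonNeg false = ℚ.≤-refl

S+half^ : ∀ {n} → (Fin n → ℕ) → (k i M : ℕ) → ℚ
S+half^ lev k i M = S lev k i M +ℚ half^ M

half^≤S+half^ : ∀ {n} (lev : Fin n → ℕ) k i M → half^ M ≤ℚ S+half^ lev k i M
half^≤S+half^ lev k i M =
  subst (_≤ℚ S+half^ lev k i M) (ℚ.+-identityˡ (half^ M)) (ℚ.+-monoˡ-≤ (half^ M) (S-nonNeg lev k i M))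

S+half^-suc : ∀ {n} (lev : Fin n → ℕ) k i M → Active lev k i (suc M) →
              S+half^ lev k i (suc M) ≡ S+half^ lev k i M
S+half^-suc lev k i M active = begin
  S+half^ lev k i (suc M)                           ≡⟨ cong (λ c → σ M +ℚ (if c then half^ (suc M) else 0ℚ) +ℚ half^ (suc M))
                                                          (⌊⌋≡true (C lev (suc M) (i ∸ 1) <? k) active) ⟩
  σ M +ℚ half^ (suc M) +ℚ half^ (suc M)             ≡⟨ ℚ.+-assoc (σ M) (half^ (suc M)) (half^ (suc M)) ⟩
  σ M +ℚ (half^ (suc M) +ℚ half^ (suc M))           ≡⟨ cong (σ M +ℚ_) (half^-suc+half^-suc M) ⟩
  S+half^ lev k i M                                 ∎
  where
  open ≡-Reasoning
  σ : ℕ → ℚ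
  σ = S lev k i

S+half^≡1 : ∀ {n} (lev : Fin n → ℕ) k i → (∀ ℓ → 1 ≤ ℓ → Active lev k i ℓ) → ∀ M → S+half^ lev k i M ≡ 1ℚ
S+half^≡1 lev k i active zero    = refl
S+half^≡1 lev k i active (suc M) =
  trans (S+half^-suc lev k i M (active (suc M) (s≤s z≤n))) (S+half^≡1 lev k i active M)

half^≤S+half^-active-above : ∀ {n} (lev : Fin n → ℕ) k i m → (∀ ℓ → suc m ≤ ℓ → Active lev k i ℓ) →
                             ∀ M → half^ m ≤ℚ S+half^ lev k i M
half^≤S+half^-active-above lev k i m active zero    = half^-antimono-≤ {0} {m} z≤n
half^≤S+half^-active-above lev k i m active (suc M) with m ≤? M
... | yes m≤M = subst (half^ m ≤ℚ_) (sym (S+half^-suc lev k i M (active (suc M) (s≤s m≤M))))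
                      (half^≤S+half^-active-above lev k i m active M)
... | no m≰M  = ℚ.≤-trans (half^-antimono-≤ (ℕ.≰⇒> m≰M)) (half^≤S+half^ lev k i (suc M))

toℚ : ℕ → ℚ
toℚ a = + a / 1

toℚ≡mkℚ : ∀ a → toℚ a ≡ mkℚ (+ a) 0 (coprime-sym (1-coprimeTo a))
toℚ≡mkℚ a = ℚ.normalize-coprime _

toℚ-mono-≤ : ∀ {a a'} → a ≤ a' → toℚ a ≤ℚ toℚ a'
toℚ-mono-≤ {a} {a'} a≤a' rewrite toℚ≡mkℚ a | toℚ≡mkℚ a' =
  *≤* (ℤ.*-monoʳ-≤-nonNeg (+ 1) (ℤ.+≤+ a≤a'))

toℚ-homo-* : ∀ a b → toℚ (a * b) ≡ toℚ a *ℚ toℚ b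
toℚ-homo-* a b = ℚ.toℚᵘ-injective (ℚᵘ.≃-trans embedded (ℚᵘ.≃-sym (ℚ.toℚᵘ-homo-* (toℚ a) (toℚ b))))
  where
  embedded : toℚᵘ (toℚ (a * b)) ℚᵘ.≃ (toℚᵘ (toℚ a) ℚᵘ.* toℚᵘ (toℚ b))
  embedded rewrite toℚ≡mkℚ (a * b) | toℚ≡mkℚ a | toℚ≡mkℚ b =
    ℚᵘ.*≡* (cong (ℤ._* + 1) (sym (ℤ.+◃n≡+n (a * b))))

toℚ[2^m*b]*half^m≡toℚb : ∀ m b → toℚ (2 ^ m * b) *ℚ half^ m ≡ toℚ b
toℚ[2^m*b]*half^m≡toℚb zero    b = trans (ℚ.*-identityʳ _) (cong toℚ (ℕ.*-identityˡ b))
toℚ[2^m*b]*half^m≡toℚb (suc m) b = begin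
  toℚ (2 ^ suc m * b) *ℚ (½ *ℚ half^ m)   ≡⟨ cong₂ _*ℚ_ (cong toℚ 2^[1+m]b≡2^m[b2]) (ℚ.*-comm ½ (half^ m)) ⟩
  toℚ (2 ^ m * (b * 2)) *ℚ (half^ m *ℚ ½) ≡⟨ ℚ.*-assoc (toℚ (2 ^ m * (b * 2))) (half^ m) ½ ⟨
  toℚ (2 ^ m * (b * 2)) *ℚ half^ m *ℚ ½   ≡⟨ cong (_*ℚ ½) (toℚ[2^m*b]*half^m≡toℚb m (b * 2)) ⟩
  toℚ (b * 2) *ℚ ½                        ≡⟨ cong (_*ℚ ½) (toℚ-homo-* b 2) ⟩
  toℚ b *ℚ toℚ 2 *ℚ ½                     ≡⟨ ℚ.*-assoc (toℚ b) (toℚ 2) ½ ⟩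
  toℚ b *ℚ 1ℚ                             ≡⟨ ℚ.*-identityʳ (toℚ b) ⟩
  toℚ b                                   ∎
  where
  open ≡-Reasoning
  2^[1+m]b≡2^m[b2] : 2 ^ suc m * b ≡ 2 ^ m * (b * 2)
  2^[1+m]b≡2^m[b2] = trans (cong (_* b) (ℕ.*-comm 2 (2 ^ m)))
                     (trans (ℕ.*-assoc (2 ^ m) 2 b) (cong (2 ^ m *_) (ℕ.*-comm 2 b)))

toℚ-≤-*-bound : ∀ m {b i x} → 2 ^ m * b ≤ i → half^ m ≤ℚ x → toℚ b ≤ℚ toℚ i *ℚ x
toℚ-≤-*-bound m {b} {i} {x} 2^mb≤i half^m≤x = begin
  toℚ b                      ≡⟨ toℚ[2^m*b]*half^m≡toℚb m b ⟨
  toℚ (2 ^ m * b) *ℚ half^ m ≤⟨ ℚ.*-monoʳ-≤-nonNeg (half^ m) {{nonNegative (half^-nonNeg m)}} (toℚ-mono-≤ 2^mb≤i) ⟩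
  toℚ i *ℚ half^ m           ≤⟨ ℚ.*-monoˡ-≤-nonNeg (toℚ i) {{ℚ.normalize-nonNeg i 1}} half^m≤x ⟩
  toℚ i *ℚ x                 ∎
  where open ℚ.≤-Reasoning

p≡1-below-2b : ∀ {n} (lev : Fin n → ℕ) {k b} → FewPerLevel lev k b →
               ∀ i → i ≤ n → i ≤ 2 * b → p lev k i ≡ 1ℚ
p≡1-below-2b {n} lev {k} few i i≤n i≤2b =
  S+half^≡1 lev k i (active-above lev 0 few i≤n i≤2b) (maxFin n lev)

b≤i*p-above-2b : ∀ {n} (lev : Fin n → ℕ) {k b} → FewPerLevel lev k b →
                 ∀ i → i ≤ n → 2 * b < i → toℚ b ≤ℚ toℚ i *ℚ p lev k i
b≤i*p-above-2b {n} lev {k} {zero} few i i≤n 2b<i =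
  toℚ-≤-*-bound M (subst (_≤ i) (sym (ℕ.*-zeroʳ (2 ^ M))) z≤n) (half^≤S+half^ lev k i M)
  where M = maxFin n lev
b≤i*p-above-2b {n} lev {k} {b@(suc _)} few i i≤n 2b<i
  with dyadic-bracket (s≤s z≤n) (ℕ.≤-trans (ℕ.m≤m+n b _) (ℕ.<⇒≤ 2b<i))
... | m , 2^mb≤i , i<2^[1+m]b =
  toℚ-≤-*-bound m 2^mb≤i
    (half^≤S+half^-active-above lev k i m (active-above lev m few i≤n (ℕ.<⇒≤ i<2^[1+m]b)) (maxFin n lev))

lemma3p5 : (n k : ℕ) → 1 ≤ n → 1 ≤ k →
    (lev : Fin n → ℕ) → (∀ j → 1 ≤ lev j) →
    -- c plays the role of ⌈√(2k log(1/δ))⌉ with δ ∈ (0,1), k ≥ 8 log(1/δ):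
    -- t = 2k log(1/δ) ranges over (0, k²/4], and c = ⌈√t⌉ ⇔ (c-1)² < t ≤ c²
    (c : ℕ) →
    Σ ℚ (λ t → (+ 0 / 1) <ℚ t × (+ 4 / 1) *ℚ t ≤ℚ (+ (k * k) / 1)
               × (+ ((c ∸ 1) * (c ∸ 1)) / 1) <ℚ t × t ≤ℚ (+ (c * c) / 1)) →
    (b : ℕ) → b ≡ k ∸ c →
    (∀ ℓ → 1 ≤ ℓ → C lev ℓ ((2 ^ ℓ * b) ⊓ n) < k) →
    ((i : ℕ) → 1 ≤ i → i ≤ n → i ≤ 2 * b → p lev k i ≡ 1ℚ)
    × ((i : ℕ) → i ≤ n → 2 * b < i → (+ b / 1) ≤ℚ (+ i / 1) *ℚ p lev k i)
lemma3p5 n k _ _ lev _ _ _ b _ few = (λ i _ → p≡1-below-2b lev few i) , b≤i*p-above-2b lev few
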